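{- Let $\mathcal{M}$ be an $8$-divisible multiset of points in $\mathrm{PG}(v-1,2)$ with cardinality $24$. Then $\gamma_1(\mathcal{M})\ge4$.
   Context: $\mathrm{PG}(v-1,2)$ is the projective geometry of $\mathbb{F}_2^v$; points and hyperplanes are subspaces of dimension $1$ and $v-1$. A multiset of points $\mathcal{M}$ assigns to each point $P$ a multiplicity $\mathcal{M}(P)\in\{0,1,2,\dots\}$; $\mathcal{M}(K)=\sum_{P\le K}\mathcal{M}(P)$ for a subspace $K$, and $\#\mathcal{M}=\mathcal{M}(\mathbb{F}_2^v)$. $\mathcal{M}$ is $\Delta$-divisible if $\mathcal{M}(H)\equiv\#\mathcal{M}\pmod\Delta$ for every hyperplane $H$. $\gamma_1(\mathcal{M})=\max_P\mathcal{M}(P)$. -}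

module Defs where

open import Data.Bool using (Bool; true; false; _∧_; _xor_; not)
open import Data.Nat using (ℕ; zero; suc; _+_; _%_; NonZero)
open import Data.Vec using (Vec; []; _∷_)
open import Data.List using (List; []; _∷_; map; _++_; filter)
open import Data.Nat.ListAction using (sum)
open import Relation.Binary.PropositionalEquality using (_≡_)
open import Relation.Nullary using (¬_)

allVecs : (v : ℕ) → List (Vec Bool v)
allVecs zero = [] ∷ []
allVecs (suc v) = map (false ∷_) (allVecs v) ++ map (true ∷_) (allVecs v)

isZero : ∀ {v} → Vec Bool v → Bool
isZero [] = true
isZero (b ∷ x) = not b ∧ isZero x

-- a nonzero vector: a point of PG(v-1,2) (each 1-dim subspace over F₂ has
-- exactly one nonzero vector)
IsPoint : ∀ {v} → Vec Bool v → Set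
IsPoint x = isZero x ≡ false

points : (v : ℕ) → List (Vec Bool v)
points v = filter (λ x → Data.Bool._≟_ (isZero x) false) (allVecs v)

dot : ∀ {v} → Vec Bool v → Vec Bool v → Bool
dot [] [] = false
dot (a ∷ as) (x ∷ xs) = (a ∧ x) xor dot as xs

-- multiset of points: multiplicity function (the value at 0 is irrelevant)
Multiset : ℕ → Set
Multiset v = Vec Bool v → ℕ

card : ∀ {v} → Multiset v → ℕ
card {v} M = sum (map M (points v))

-- M(H_a) where H_a = {x : a·x = 0}; every hyperplane of F₂^v is H_a for
-- a unique nonzero a
hypMass : ∀ {v} → Multiset v → Vec Bool v → ℕ
hypMass {v} M a = sum (map M (filter (λ x → Data.Bool._≟_ (dot a x) false) (points v)))

Divisible : ∀ {v} → (Δ : ℕ) → .{{NonZero Δ}} → Multiset v → Set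
Divisible {v} Δ M = (a : Vec Bool v) → IsPoint a → hypMass M a % Δ ≡ card M % Δ

-- Let m be the multiplicity function of M on 𝔽₂^v (zero at the origin) and 𝓕 its Walsh–Hadamard
-- transform, 𝓕(a) = Σₓ m(x)(−1)^{a·x} = 2·M(H_a) − #M. Every hyperplane has multiplicity 0, 8, 16
-- or 24, so 𝓕(a)² ∈ {64, 576} and 𝓕⁴ = 640𝓕² − 36864. Since 𝓕² is the transform of the
-- autocorrelation E(u) = Σₓ m(x)m(x+u), Parseval for m and for E gives Σᵤ E(u)² = 640S − 36864 with
-- S = Σ m². On the other hand E(0) = S, and for u ≠ 0 the square of the nonnegative sum E(u) is at
-- least the sum of its squared terms, so Σᵤ E(u)² ≥ 2S² − Σ m⁴. If all multiplicities were at most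
-- 3, then Σ m⁴ ≤ 9S and S ≤ 3·24 = 72, and 2S² − 649S + 36864 > 0 on [0, 72] gives a contradiction.
module Submission where

open import Defs
open import Algebra.Bundles using (CommutativeRing)
import Algebra.Properties.CommutativeSemigroup as CommutativeSemigroupProperties
open import Data.Bool as Bool using (Bool; true; false; _∧_; _xor_; if_then_else_)
open import Data.Bool.Properties using (∧-distribˡ-xor; xor-identityʳ; xor-∧-commutativeRing; if-float)
open import Data.Vec using (Vec; []; _∷_; zipWith; replicate)
open import Data.Vec.Properties using (zipWith-identityʳ)
open import Data.List using (List; []; _∷_; map; filter; _++_)
open import Data.List.Properties using (map-++; map-∘; map-cong)
open import Data.Nat.ListAction using (sum)
open import Data.Nat.ListAction.Properties using (sum-++)
open import Data.Nat as ℕ using (ℕ; zero; suc; _^_; _≤_; z≤n; s≤s)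
import Data.Nat.Properties as ℕ
open import Data.Nat.Divisibility using (_∣_; divides; m%n≡0⇒n∣m; n∣m⇒m%n≡0)
open import Data.Integer as ℤ using (ℤ; +_; -_; _+_; _-_; _*_; +≤+; +<+; 0ℤ; 1ℤ; -1ℤ; nonNegative)
import Data.Integer.Properties as ℤ
open import Data.Integer.Tactic.RingSolver using (solve-∀)
open import Data.Product using (Σ; ∃; _×_; _,_)
open import Data.Sum using (inj₁; inj₂)
open import Data.Empty using (⊥; ⊥-elim)
open import Function using (_∘_)
open import Level using (0ℓ)
open import Relation.Nullary using (Dec; ¬_; does)
open import Relation.Nullary.Decidable using (map′; _⊎-dec_; _×-dec_; decidable-stable)
open import Relation.Unary using (Pred; Decidable)
open import Relation.Binary.PropositionalEquality

open CommutativeSemigroupProperties ℤ.+-commutativeSemigroup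
  using () renaming (interchange to +-interchange)
open CommutativeSemigroupProperties (CommutativeRing.+-commutativeSemigroup xor-∧-commutativeRing)
  using () renaming (interchange to xor-interchange)

∑ : (v : ℕ) → (Vec Bool v → ℤ) → ℤ
∑ zero    f = f []
∑ (suc v) f = ∑ v (f ∘ (false ∷_)) + ∑ v (f ∘ (true ∷_))

syntax ∑ v (λ x → e) = ∑[ x ∈𝔽₂^ v ] e

∑-cong : ∀ {v} {f g : Vec Bool v → ℤ} → (∀ x → f x ≡ g x) → ∑ v f ≡ ∑ v g
∑-cong {zero}  f≡g = f≡g []
∑-cong {suc v} f≡g = cong₂ _+_ (∑-cong (f≡g ∘ (false ∷_))) (∑-cong (f≡g ∘ (true ∷_)))

∑-distrib-+ : ∀ {v} (f g : Vec Bool v → ℤ) → ∑[ x ∈𝔽₂^ v ] (f x + g x) ≡ ∑ v f + ∑ v g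
∑-distrib-+ {zero}  f g = refl
∑-distrib-+ {suc v} f g = trans (cong₂ _+_ (∑-distrib-+ f₀ g₀) (∑-distrib-+ f₁ g₁))
                                (+-interchange (∑ v f₀) (∑ v g₀) (∑ v f₁) (∑ v g₁))
  where
  f₀ f₁ g₀ g₁ : Vec Bool v → ℤ
  f₀ = f ∘ (false ∷_)
  f₁ = f ∘ (true ∷_)
  g₀ = g ∘ (false ∷_)
  g₁ = g ∘ (true ∷_)

∑-distribˡ-* : ∀ {v} c (f : Vec Bool v → ℤ) → ∑[ x ∈𝔽₂^ v ] (c * f x) ≡ c * ∑ v f
∑-distribˡ-* {zero}  c f = refl
∑-distribˡ-* {suc v} c f = trans
  (cong₂ _+_ (∑-distribˡ-* c (f ∘ (false ∷_))) (∑-distribˡ-* c (f ∘ (true ∷_))))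
  (sym (ℤ.*-distribˡ-+ c _ _))

∑-distribʳ-* : ∀ {v} c (f : Vec Bool v → ℤ) → ∑[ x ∈𝔽₂^ v ] (f x * c) ≡ ∑ v f * c
∑-distribʳ-* c f = trans (∑-cong (λ x → ℤ.*-comm (f x) c)) (trans (∑-distribˡ-* c f) (ℤ.*-comm c _))

+2^suc-* : ∀ v c → + (2 ^ suc v) * c ≡ + (2 ^ v) * c + + (2 ^ v) * c
+2^suc-* v c = begin
  + (2 ^ suc v) * c                ≡⟨ cong (λ n → + (2 ^ v ℕ.+ n) * c) (ℕ.+-identityʳ (2 ^ v)) ⟩
  + (2 ^ v ℕ.+ 2 ^ v) * c          ≡⟨ cong (_* c) (ℤ.pos-+ (2 ^ v) (2 ^ v)) ⟩
  (+ (2 ^ v) + + (2 ^ v)) * c      ≡⟨ ℤ.*-distribʳ-+ c (+ (2 ^ v)) (+ (2 ^ v)) ⟩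
  + (2 ^ v) * c + + (2 ^ v) * c    ∎
  where open ≡-Reasoning

∑-const : ∀ {v} c → ∑[ _ ∈𝔽₂^ v ] c ≡ + (2 ^ v) * c
∑-const {zero}  c = sym (ℤ.*-identityˡ c)
∑-const {suc v} c = trans (cong₂ _+_ (∑-const {v} c) (∑-const {v} c)) (sym (+2^suc-* v c))

∑-swap : ∀ {v w} (g : Vec Bool v → Vec Bool w → ℤ) →
         ∑[ x ∈𝔽₂^ v ] ∑[ y ∈𝔽₂^ w ] g x y ≡ ∑[ y ∈𝔽₂^ w ] ∑[ x ∈𝔽₂^ v ] g x y
∑-swap {zero}  g = refl
∑-swap {suc v} g = trans
  (cong₂ _+_ (∑-swap (g ∘ (false ∷_))) (∑-swap (g ∘ (true ∷_))))
  (sym (∑-distrib-+ (λ y → ∑ v (λ x → g (false ∷ x) y)) (λ y → ∑ v (λ x → g (true ∷ x) y))))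

∑-mono-≤ : ∀ {v} {f g : Vec Bool v → ℤ} → (∀ x → f x ℤ.≤ g x) → ∑ v f ℤ.≤ ∑ v g
∑-mono-≤ {zero}  f≤g = f≤g []
∑-mono-≤ {suc v} f≤g = ℤ.+-mono-≤ (∑-mono-≤ (f≤g ∘ (false ∷_))) (∑-mono-≤ (f≤g ∘ (true ∷_)))

∑-nonNeg : ∀ {v} {f : Vec Bool v → ℤ} → (∀ x → 0ℤ ℤ.≤ f x) → 0ℤ ℤ.≤ ∑ v f
∑-nonNeg {zero}  0≤f = 0≤f []
∑-nonNeg {suc v} 0≤f = ℤ.+-mono-≤ (∑-nonNeg (0≤f ∘ (false ∷_))) (∑-nonNeg (0≤f ∘ (true ∷_)))

∑² ∑⁴ : ∀ {v} → (Vec Bool v → ℤ) → ℤ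
∑² {v} g = ∑[ x ∈𝔽₂^ v ] (g x * g x)
∑⁴ {v} g = ∑[ x ∈𝔽₂^ v ] ((g x * g x) * (g x * g x))

*-nonNeg : ∀ {i j} → 0ℤ ℤ.≤ i → 0ℤ ℤ.≤ j → 0ℤ ℤ.≤ i * j
*-nonNeg {j = j} 0≤i 0≤j = ℤ.*-monoʳ-≤-nonNeg j {{nonNegative 0≤j}} 0≤i

square-≤ : ∀ {i} c → 0ℤ ℤ.≤ i → i ℤ.≤ c → i * i ℤ.≤ c * i
square-≤ {i} c 0≤i i≤c = ℤ.*-monoʳ-≤-nonNeg i {{nonNegative 0≤i}} i≤c

∑²≤∑*∑ : ∀ {v} (f : Vec Bool v → ℤ) → (∀ x → 0ℤ ℤ.≤ f x) → ∑² f ℤ.≤ ∑ v f * ∑ v f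
∑²≤∑*∑ {zero}  f 0≤f = ℤ.≤-refl
∑²≤∑*∑ {suc v} f 0≤f = begin
  ∑² f₀ + ∑² f₁
    ≤⟨ ℤ.+-mono-≤ (∑²≤∑*∑ f₀ (0≤f ∘ (false ∷_))) (∑²≤∑*∑ f₁ (0≤f ∘ (true ∷_))) ⟩
  A * A + B * B
    ≤⟨ ℤ.i≤i+j (A * A + B * B) (+ 2 * (A * B)) {{nonNegative 0≤2AB}} ⟩
  A * A + B * B + + 2 * (A * B)
    ≡⟨ square-of-sum A B ⟩
  (A + B) * (A + B) ∎
  where
  open ℤ.≤-Reasoning
  f₀ f₁ : Vec Bool v → ℤ
  f₀ = f ∘ (false ∷_)
  f₁ = f ∘ (true ∷_)
  A = ∑ v f₀
  B = ∑ v f₁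
  0≤2AB : 0ℤ ℤ.≤ + 2 * (A * B)
  0≤2AB = *-nonNeg {+ 2} (+≤+ z≤n)
            (*-nonNeg (∑-nonNeg (0≤f ∘ (false ∷_))) (∑-nonNeg (0≤f ∘ (true ∷_))))
  square-of-sum : ∀ a b → a * a + b * b + + 2 * (a * b) ≡ (a + b) * (a + b)
  square-of-sum = solve-∀

_⊕_ : ∀ {v} → Vec Bool v → Vec Bool v → Vec Bool v
_⊕_ = zipWith _xor_

𝟎 : ∀ {v} → Vec Bool v
𝟎 = replicate _ false

⊕-identityʳ : ∀ {v} (x : Vec Bool v) → x ⊕ 𝟎 ≡ x
⊕-identityʳ = zipWith-identityʳ xor-identityʳ

isZero⇒≡𝟎 : ∀ {v} (x : Vec Bool v) → isZero x ≡ true → x ≡ 𝟎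
isZero⇒≡𝟎 []          _  = refl
isZero⇒≡𝟎 (false ∷ x) eq = cong (false ∷_) (isZero⇒≡𝟎 x eq)

∃? : ∀ v {P : Vec Bool v → Set} → (∀ x → Dec (P x)) → Dec (∃ P)
∃? zero    P? = map′ ([] ,_) (λ { ([] , p) → p }) (P? [])
∃? (suc v) P? = map′
  (λ { (inj₁ (x , p)) → false ∷ x , p ; (inj₂ (x , p)) → true ∷ x , p })
  (λ { (false ∷ x , p) → inj₁ (x , p) ; (true ∷ x , p) → inj₂ (x , p) })
  (∃? v (P? ∘ (false ∷_)) ⊎-dec ∃? v (P? ∘ (true ∷_)))

∑-translate : ∀ {v} (x : Vec Bool v) (f : Vec Bool v → ℤ) → ∑ v f ≡ ∑[ u ∈𝔽₂^ v ] f (x ⊕ u)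
∑-translate []          f = refl
∑-translate (false ∷ x) f = cong₂ _+_ (∑-translate x (f ∘ (false ∷_))) (∑-translate x (f ∘ (true ∷_)))
∑-translate {suc v} (true ∷ x) f = trans (ℤ.+-comm (∑ v (f ∘ (false ∷_))) _)
  (cong₂ _+_ (∑-translate x (f ∘ (true ∷_))) (∑-translate x (f ∘ (false ∷_))))

δ₀ : ∀ {v} → Vec Bool v → ℤ
δ₀ x = if isZero x then 1ℤ else 0ℤ

∑-δ₀ : ∀ {v} (f : Vec Bool v → ℤ) → ∑[ x ∈𝔽₂^ v ] (δ₀ x * f x) ≡ f 𝟎
∑-δ₀ {zero}  f = ℤ.*-identityˡ (f [])
∑-δ₀ {suc v} f = trans
  (cong₂ _+_ (∑-δ₀ (f ∘ (false ∷_))) (∑-distribˡ-* 0ℤ (f ∘ (true ∷_))))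
  (ℤ.+-identityʳ _)

dot-⊕ : ∀ {v} (a x y : Vec Bool v) → dot a (x ⊕ y) ≡ dot a x xor dot a y
dot-⊕ []      []      []      = refl
dot-⊕ (b ∷ a) (c ∷ x) (d ∷ y) = begin
  (b ∧ (c xor d)) xor dot a (x ⊕ y)
    ≡⟨ cong₂ _xor_ (∧-distribˡ-xor b c d) (dot-⊕ a x y) ⟩
  ((b ∧ c) xor (b ∧ d)) xor (dot a x xor dot a y)
    ≡⟨ xor-interchange (b ∧ c) (b ∧ d) (dot a x) (dot a y) ⟩
  ((b ∧ c) xor dot a x) xor ((b ∧ d) xor dot a y) ∎
  where open ≡-Reasoning

dotˡ-𝟎 : ∀ {v} (x : Vec Bool v) → dot 𝟎 x ≡ false
dotˡ-𝟎 []      = refl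
dotˡ-𝟎 (_ ∷ x) = dotˡ-𝟎 x

χ : ∀ {v} → Vec Bool v → Vec Bool v → ℤ
χ a x = if dot a x then -1ℤ else 1ℤ

χ-⊕ : ∀ {v} (a x y : Vec Bool v) → χ a (x ⊕ y) ≡ χ a x * χ a y
χ-⊕ a x y rewrite dot-⊕ a x y with dot a x | dot a y
... | false | false = refl
... | false | true  = refl
... | true  | false = refl
... | true  | true  = refl

χ-square : ∀ {v} (a x : Vec Bool v) → χ a x * χ a x ≡ 1ℤ
χ-square a x with dot a x
... | false = refl
... | true  = refl

χ-flip : ∀ {v} (a x : Vec Bool v) → χ (true ∷ a) (true ∷ x) ≡ -1ℤ * χ a x
χ-flip a x with dot a x
... | false = refl
... | true  = refl

∑-χ : ∀ {v} (x : Vec Bool v) → ∑[ a ∈𝔽₂^ v ] χ a x ≡ + (2 ^ v) * δ₀ x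
∑-χ []          = refl
∑-χ {suc v} (false ∷ x) = begin
  ∑ v (λ a → χ a x) + ∑ v (λ a → χ a x)     ≡⟨ cong₂ _+_ (∑-χ x) (∑-χ x) ⟩
  + (2 ^ v) * δ₀ x + + (2 ^ v) * δ₀ x       ≡⟨ +2^suc-* v (δ₀ x) ⟨
  + (2 ^ suc v) * δ₀ x                      ∎
  where open ≡-Reasoning
∑-χ {suc v} (true ∷ x)  = begin
  ∑ v (λ a → χ a x) + ∑ v (λ a → χ (true ∷ a) (true ∷ x))
    ≡⟨ cong (_+_ (∑ v (λ a → χ a x))) (∑-cong (λ a → χ-flip a x)) ⟩
  ∑ v (λ a → χ a x) + ∑ v (λ a → -1ℤ * χ a x)
    ≡⟨ cong (_+_ (∑ v (λ a → χ a x))) (∑-distribˡ-* -1ℤ (λ a → χ a x)) ⟩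
  ∑ v (λ a → χ a x) + -1ℤ * ∑ v (λ a → χ a x)
    ≡⟨ cancel (∑ v (λ a → χ a x)) ⟩
  0ℤ
    ≡⟨ ℤ.*-zeroʳ (+ (2 ^ suc v)) ⟨
  + (2 ^ suc v) * 0ℤ ∎
  where
  open ≡-Reasoning
  cancel : ∀ s → s + -1ℤ * s ≡ 0ℤ
  cancel = solve-∀

𝓕 : ∀ {v} → (Vec Bool v → ℤ) → Vec Bool v → ℤ
𝓕 {v} g a = ∑[ x ∈𝔽₂^ v ] (g x * χ a x)

autocorrelation : ∀ {v} → (Vec Bool v → ℤ) → Vec Bool v → ℤ
autocorrelation {v} g u = ∑[ x ∈𝔽₂^ v ] (g x * g (x ⊕ u))

𝓕-square : ∀ {v} (g : Vec Bool v → ℤ) a → 𝓕 g a * 𝓕 g a ≡ 𝓕 (autocorrelation g) a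
𝓕-square {v} g a = begin
  𝓕 g a * 𝓕 g a
    ≡⟨ ∑-distribʳ-* (𝓕 g a) (λ x → g x * χ a x) ⟨
  ∑[ x ∈𝔽₂^ v ] (g x * χ a x * 𝓕 g a)
    ≡⟨ ∑-cong (λ x → cong (g x * χ a x *_) (∑-translate x (λ y → g y * χ a y))) ⟩
  ∑[ x ∈𝔽₂^ v ] (g x * χ a x * ∑[ u ∈𝔽₂^ v ] (g (x ⊕ u) * χ a (x ⊕ u)))
    ≡⟨ ∑-cong (λ x → ∑-distribˡ-* (g x * χ a x) (λ u → g (x ⊕ u) * χ a (x ⊕ u))) ⟨
  ∑[ x ∈𝔽₂^ v ] ∑[ u ∈𝔽₂^ v ] (g x * χ a x * (g (x ⊕ u) * χ a (x ⊕ u)))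
    ≡⟨ ∑-cong (λ x → ∑-cong (cancel-χ x)) ⟩
  ∑[ x ∈𝔽₂^ v ] ∑[ u ∈𝔽₂^ v ] (g x * g (x ⊕ u) * χ a u)
    ≡⟨ ∑-swap (λ x u → g x * g (x ⊕ u) * χ a u) ⟩
  ∑[ u ∈𝔽₂^ v ] ∑[ x ∈𝔽₂^ v ] (g x * g (x ⊕ u) * χ a u)
    ≡⟨ ∑-cong (λ u → ∑-distribʳ-* (χ a u) (λ x → g x * g (x ⊕ u))) ⟩
  𝓕 (autocorrelation g) a ∎
  where
  open ≡-Reasoning
  regroup : ∀ p q c d → p * c * (q * (c * d)) ≡ p * q * d * (c * c)
  regroup = solve-∀
  cancel-χ : ∀ x u → g x * χ a x * (g (x ⊕ u) * χ a (x ⊕ u)) ≡ g x * g (x ⊕ u) * χ a u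
  cancel-χ x u = begin
    g x * χ a x * (g (x ⊕ u) * χ a (x ⊕ u))
      ≡⟨ cong (λ t → g x * χ a x * (g (x ⊕ u) * t)) (χ-⊕ a x u) ⟩
    g x * χ a x * (g (x ⊕ u) * (χ a x * χ a u))
      ≡⟨ regroup (g x) (g (x ⊕ u)) (χ a x) (χ a u) ⟩
    g x * g (x ⊕ u) * χ a u * (χ a x * χ a x)
      ≡⟨ cong (g x * g (x ⊕ u) * χ a u *_) (χ-square a x) ⟩
    g x * g (x ⊕ u) * χ a u * 1ℤ
      ≡⟨ ℤ.*-identityʳ _ ⟩
    g x * g (x ⊕ u) * χ a u ∎

∑-𝓕 : ∀ {v} (h : Vec Bool v → ℤ) → ∑[ a ∈𝔽₂^ v ] 𝓕 h a ≡ + (2 ^ v) * h 𝟎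
∑-𝓕 {v} h = begin
  ∑[ a ∈𝔽₂^ v ] ∑[ x ∈𝔽₂^ v ] (h x * χ a x)   ≡⟨ ∑-swap (λ a x → h x * χ a x) ⟩
  ∑[ x ∈𝔽₂^ v ] ∑[ a ∈𝔽₂^ v ] (h x * χ a x)   ≡⟨ ∑-cong (λ x → ∑-distribˡ-* (h x) (λ a → χ a x)) ⟩
  ∑[ x ∈𝔽₂^ v ] (h x * ∑[ a ∈𝔽₂^ v ] χ a x)   ≡⟨ ∑-cong (λ x → cong (h x *_) (∑-χ x)) ⟩
  ∑[ x ∈𝔽₂^ v ] (h x * (+ (2 ^ v) * δ₀ x))    ≡⟨ ∑-cong (λ x → regroup (h x) (+ (2 ^ v)) (δ₀ x)) ⟩
  ∑[ x ∈𝔽₂^ v ] (δ₀ x * (+ (2 ^ v) * h x))    ≡⟨ ∑-δ₀ (λ x → + (2 ^ v) * h x) ⟩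
  + (2 ^ v) * h 𝟎                             ∎
  where
  open ≡-Reasoning
  regroup : ∀ p n d → p * (n * d) ≡ d * (n * p)
  regroup = solve-∀

𝓕-+-∑ : ∀ {v} (g : Vec Bool v → ℤ) a →
        𝓕 g a + ∑ v g ≡ + 2 * ∑[ x ∈𝔽₂^ v ] (if dot a x then 0ℤ else g x)
𝓕-+-∑ {v} g a = trans (sym (∑-distrib-+ (λ x → g x * χ a x) g))
                 (trans (∑-cong pointwise) (∑-distribˡ-* (+ 2) (λ x → if dot a x then 0ℤ else g x)))
  where
  cancel : ∀ y → y * -1ℤ + y ≡ + 2 * 0ℤ
  cancel = solve-∀
  double : ∀ y → y * 1ℤ + y ≡ + 2 * y
  double = solve-∀
  pointwise : ∀ x → g x * χ a x + g x ≡ + 2 * (if dot a x then 0ℤ else g x)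
  pointwise x with dot a x
  ... | true  = cancel (g x)
  ... | false = double (g x)

autocorrelation-𝟎 : ∀ {v} (g : Vec Bool v → ℤ) → autocorrelation g 𝟎 ≡ ∑² g
autocorrelation-𝟎 g = ∑-cong (λ x → cong (λ y → g x * g y) (⊕-identityʳ x))

parseval : ∀ {v} (g : Vec Bool v → ℤ) → ∑² (𝓕 g) ≡ + (2 ^ v) * ∑² g
parseval {v} g = begin
  ∑² (𝓕 g)                             ≡⟨ ∑-cong (𝓕-square g) ⟩
  ∑[ a ∈𝔽₂^ v ] 𝓕 (autocorrelation g) a ≡⟨ ∑-𝓕 (autocorrelation g) ⟩
  + (2 ^ v) * autocorrelation g 𝟎      ≡⟨ cong (+ (2 ^ v) *_) (autocorrelation-𝟎 g) ⟩
  + (2 ^ v) * ∑² g                     ∎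
  where open ≡-Reasoning

∑⁴-𝓕 : ∀ {v} (g : Vec Bool v → ℤ) → ∑⁴ (𝓕 g) ≡ + (2 ^ v) * ∑² (autocorrelation g)
∑⁴-𝓕 g = trans (∑-cong (λ a → cong₂ _*_ (𝓕-square g a) (𝓕-square g a))) (parseval (autocorrelation g))

∑²-autocorrelation-of-quartic : ∀ {v} (g : Vec Bool v → ℤ) p q →
  (∀ a → (𝓕 g a * 𝓕 g a) * (𝓕 g a * 𝓕 g a) ≡ p * (𝓕 g a * 𝓕 g a) - q) →
  ∑² (autocorrelation g) ≡ p * ∑² g - q
∑²-autocorrelation-of-quartic {v} g p q quartic = ℤ.*-cancelˡ-≡ (+ (2 ^ v)) _ _ {{ℕ.m^n≢0 2 v}} (begin
  + (2 ^ v) * ∑² (autocorrelation g)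
    ≡⟨ ∑⁴-𝓕 g ⟨
  ∑⁴ (𝓕 g)
    ≡⟨ ∑-cong quartic ⟩
  ∑[ a ∈𝔽₂^ v ] (p * (𝓕 g a * 𝓕 g a) - q)
    ≡⟨ ∑-distrib-+ (λ a → p * (𝓕 g a * 𝓕 g a)) (λ _ → - q) ⟩
  ∑[ a ∈𝔽₂^ v ] (p * (𝓕 g a * 𝓕 g a)) + ∑[ _ ∈𝔽₂^ v ] (- q)
    ≡⟨ cong₂ _+_ (∑-distribˡ-* p (λ a → 𝓕 g a * 𝓕 g a)) (∑-const {v} (- q)) ⟩
  p * ∑² (𝓕 g) + + (2 ^ v) * (- q)
    ≡⟨ cong (λ t → p * t + + (2 ^ v) * (- q)) (parseval g) ⟩
  p * (+ (2 ^ v) * ∑² g) + + (2 ^ v) * (- q)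
    ≡⟨ factor (+ (2 ^ v)) p q (∑² g) ⟩
  + (2 ^ v) * (p * ∑² g - q) ∎)
  where
  open ≡-Reasoning
  factor : ∀ n p q s → p * (n * s) + n * (- q) ≡ n * (p * s - q)
  factor = solve-∀

∑²-autocorrelation-lower-bound : ∀ {v} (g : Vec Bool v → ℤ) → (∀ x → 0ℤ ℤ.≤ g x) →
  + 2 * (∑² g * ∑² g) - ∑⁴ g ℤ.≤ ∑² (autocorrelation g)
∑²-autocorrelation-lower-bound {v} g 0≤g = begin
  + 2 * (S * S) - ∑⁴ g
    ≡⟨ split (S * S) (∑⁴ g) ⟩
  (S * S - ∑⁴ g) + S * S
    ≡⟨ cong₂ _+_ (∑-δ₀ {v} (λ _ → S * S - ∑⁴ g)) ∑∑-products² ⟨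
  ∑[ u ∈𝔽₂^ v ] (δ₀ u * (S * S - ∑⁴ g)) + ∑[ u ∈𝔽₂^ v ] ∑² (products u)
    ≡⟨ ∑-distrib-+ (λ u → δ₀ u * (S * S - ∑⁴ g)) (λ u → ∑² (products u)) ⟨
  ∑[ u ∈𝔽₂^ v ] (δ₀ u * (S * S - ∑⁴ g) + ∑² (products u))
    ≤⟨ ∑-mono-≤ pointwise ⟩
  ∑² (autocorrelation g) ∎
  where
  open ℤ.≤-Reasoning
  S = ∑² g
  products : Vec Bool v → Vec Bool v → ℤ
  products u x = g x * g (x ⊕ u)
  split : ∀ s q → + 2 * s - q ≡ (s - q) + s
  split = solve-∀
  products-𝟎 : ∀ x → products 𝟎 x ≡ g x * g x
  products-𝟎 x = cong (λ y → g x * g y) (⊕-identityʳ x)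
  regroup : ∀ p q → p * q * (p * q) ≡ p * p * (q * q)
  regroup = solve-∀
  ∑∑-products² : ∑[ u ∈𝔽₂^ v ] ∑² (products u) ≡ S * S
  ∑∑-products² = begin-equality
    ∑[ u ∈𝔽₂^ v ] ∑[ x ∈𝔽₂^ v ] (products u x * products u x)
      ≡⟨ ∑-swap (λ u x → products u x * products u x) ⟩
    ∑[ x ∈𝔽₂^ v ] ∑[ u ∈𝔽₂^ v ] (products u x * products u x)
      ≡⟨ ∑-cong (λ x → ∑-cong (λ u → regroup (g x) (g (x ⊕ u)))) ⟩
    ∑[ x ∈𝔽₂^ v ] ∑[ u ∈𝔽₂^ v ] (g x * g x * (g (x ⊕ u) * g (x ⊕ u)))
      ≡⟨ ∑-cong (λ x → ∑-distribˡ-* (g x * g x) (λ u → g (x ⊕ u) * g (x ⊕ u))) ⟩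
    ∑[ x ∈𝔽₂^ v ] (g x * g x * ∑[ u ∈𝔽₂^ v ] (g (x ⊕ u) * g (x ⊕ u)))
      ≡⟨ ∑-cong (λ x → cong (g x * g x *_) (∑-translate x (λ y → g y * g y))) ⟨
    ∑[ x ∈𝔽₂^ v ] (g x * g x * S)
      ≡⟨ ∑-distribʳ-* S (λ x → g x * g x) ⟩
    S * S ∎
  at-𝟎 : 1ℤ * (S * S - ∑⁴ g) + ∑² (products 𝟎) ≡ autocorrelation g 𝟎 * autocorrelation g 𝟎
  at-𝟎 = begin-equality
    1ℤ * (S * S - ∑⁴ g) + ∑² (products 𝟎)
      ≡⟨ cong (_+_ (1ℤ * (S * S - ∑⁴ g))) (∑-cong (λ x → cong₂ _*_ (products-𝟎 x) (products-𝟎 x))) ⟩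
    1ℤ * (S * S - ∑⁴ g) + ∑⁴ g
      ≡⟨ cancel (S * S) (∑⁴ g) ⟩
    S * S
      ≡⟨ cong₂ _*_ (autocorrelation-𝟎 g) (autocorrelation-𝟎 g) ⟨
    autocorrelation g 𝟎 * autocorrelation g 𝟎 ∎
    where
    cancel : ∀ s q → 1ℤ * (s - q) + q ≡ s
    cancel = solve-∀
  pointwise : ∀ u → δ₀ u * (S * S - ∑⁴ g) + ∑² (products u) ℤ.≤ autocorrelation g u * autocorrelation g u
  pointwise u with isZero u in u≡𝟎
  ... | true rewrite isZero⇒≡𝟎 u u≡𝟎 = ℤ.≤-reflexive at-𝟎
  ... | false = ℤ.≤-trans (ℤ.≤-reflexive (ℤ.+-identityˡ _))
                  (∑²≤∑*∑ (products u) (λ x → *-nonNeg (0≤g x) (0≤g (x ⊕ u))))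

quadratic-gap : ∀ S Q → S ℤ.≤ + 72 → Q ℤ.≤ + 9 * S → ¬ (+ 2 * (S * S) - Q ℤ.≤ + 640 * S - + 36864)
quadratic-gap S Q S≤72 Q≤9S h = ℤ.<⇒≱ (+<+ (s≤s z≤n)) 504≤0
  where
  open ℤ.≤-Reasoning
  T = + 72 - S
  0≤T : 0ℤ ℤ.≤ T
  0≤T = ℤ.i≤j⇒0≤j-i S≤72
  0≤2T²+361T : 0ℤ ℤ.≤ + 2 * (T * T) + + 361 * T
  0≤2T²+361T = ℤ.+-mono-≤ (*-nonNeg {+ 2} (+≤+ z≤n) (*-nonNeg 0≤T 0≤T)) (*-nonNeg {+ 361} (+≤+ z≤n) 0≤T)
  -- In T = 72 − S the polynomial 2S² − 649S + 36864 has positive coefficients.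
  expand : ∀ s → + 2 * ((+ 72 - s) * (+ 72 - s)) + + 361 * (+ 72 - s) + + 504
               ≡ (+ 2 * (s * s) - + 9 * s) - (+ 640 * s - + 36864)
  expand = solve-∀
  504≤0 : + 504 ℤ.≤ 0ℤ
  504≤0 = begin
    + 504
      ≤⟨ ℤ.i≤j+i (+ 504) _ {{nonNegative 0≤2T²+361T}} ⟩
    + 2 * (T * T) + + 361 * T + + 504
      ≡⟨ expand S ⟩
    (+ 2 * (S * S) - + 9 * S) - (+ 640 * S - + 36864)
      ≤⟨ ℤ.+-monoˡ-≤ _ (ℤ.+-monoʳ-≤ (+ 2 * (S * S)) (ℤ.neg-mono-≤ Q≤9S)) ⟩
    (+ 2 * (S * S) - Q) - (+ 640 * S - + 36864)
      ≤⟨ ℤ.i≤j⇒i-j≤0 h ⟩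
    0ℤ ∎

hyperplane-quartic : ∀ n f → 8 ∣ n → n ≤ 24 → f + + 24 ≡ + 2 * + n →
                     (f * f) * (f * f) ≡ + 640 * (f * f) - + 36864
hyperplane-quartic .(q ℕ.* 8) f (divides q refl) n≤24 f+24≡2n =
  subst (λ f → (f * f) * (f * f) ≡ + 640 * (f * f) - + 36864) (sym f≡) (values q n≤24)
  where
  shift : ∀ f c → f ≡ (f + c) - c
  shift = solve-∀
  f≡ : f ≡ + 2 * + (q ℕ.* 8) - + 24
  f≡ = trans (shift f (+ 24)) (cong (_- + 24) f+24≡2n)
  values : ∀ q → q ℕ.* 8 ≤ 24 → let f = + 2 * + (q ℕ.* 8) - + 24 in
           (f * f) * (f * f) ≡ + 640 * (f * f) - + 36864
  values 0 _ = refl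
  values 1 _ = refl
  values 2 _ = refl
  values 3 _ = refl
  values (suc (suc (suc (suc q)))) 8q≤24 = ⊥-elim (ℕ.<⇒≱ (ℕ.m≤m+n 25 _) 8q≤24)

sum-filter : ∀ {A : Set} {P : Pred A 0ℓ} (P? : Decidable P) (f : A → ℕ) (xs : List A) →
             sum (map f (filter P? xs)) ≡ sum (map (λ x → if does (P? x) then f x else 0) xs)
sum-filter P? f []       = refl
sum-filter P? f (x ∷ xs) with does (P? x)
... | true  = cong (f x ℕ.+_) (sum-filter P? f xs)
... | false = sum-filter P? f xs

sum-allVecs : ∀ v (f : Vec Bool v → ℕ) → + sum (map f (allVecs v)) ≡ ∑[ x ∈𝔽₂^ v ] (+ f x)
sum-allVecs zero    f = cong +_ (ℕ.+-identityʳ (f []))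
sum-allVecs (suc v) f = begin
  + sum (map f (map (false ∷_) xs ++ map (true ∷_) xs))
    ≡⟨ cong (+_ ∘ sum) (map-++ f (map (false ∷_) xs) (map (true ∷_) xs)) ⟩
  + sum (map f (map (false ∷_) xs) ++ map f (map (true ∷_) xs))
    ≡⟨ cong +_ (sum-++ (map f (map (false ∷_) xs)) (map f (map (true ∷_) xs))) ⟩
  + (sum (map f (map (false ∷_) xs)) ℕ.+ sum (map f (map (true ∷_) xs)))
    ≡⟨ ℤ.pos-+ (sum (map f (map (false ∷_) xs))) (sum (map f (map (true ∷_) xs))) ⟩
  + sum (map f (map (false ∷_) xs)) + + sum (map f (map (true ∷_) xs))
    ≡⟨ cong₂ _+_ (half false) (half true) ⟩
  ∑[ x ∈𝔽₂^ suc v ] (+ f x) ∎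
  where
  open ≡-Reasoning
  xs = allVecs v
  half : ∀ b → + sum (map f (map (b ∷_) xs)) ≡ ∑[ x ∈𝔽₂^ v ] (+ f (b ∷ x))
  half b = trans (cong (+_ ∘ sum) (sym (map-∘ xs))) (sum-allVecs v (f ∘ (b ∷_)))

-- A Multiset assigns a junk value to the zero vector; mult replaces it by 0.
mult : ∀ {v} → Multiset v → Vec Bool v → ℕ
mult M x = if isZero x then 0 else M x

card-∑ : ∀ {v} (M : Multiset v) → + card M ≡ ∑[ x ∈𝔽₂^ v ] (+ mult M x)
card-∑ {v} M = trans (cong +_ (trans (sum-filter (λ x → isZero x Bool.≟ false) M (allVecs v))
                                     (cong sum (map-cong pointwise (allVecs v)))))
                     (sum-allVecs v (mult M))
  where
  pointwise : ∀ x → (if does (isZero x Bool.≟ false) then M x else 0) ≡ mult M x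
  pointwise x with isZero x
  ... | true  = refl
  ... | false = refl

hypMass-∑ : ∀ {v} (M : Multiset v) a →
            + hypMass M a ≡ ∑[ x ∈𝔽₂^ v ] (if dot a x then 0ℤ else + mult M x)
hypMass-∑ {v} M a = begin
  + sum (map M (filter (λ x → dot a x Bool.≟ false) (points v)))
    ≡⟨ cong +_ (sum-filter (λ x → dot a x Bool.≟ false) M (points v)) ⟩
  + sum (map inH (filter (λ x → isZero x Bool.≟ false) (allVecs v)))
    ≡⟨ cong +_ (sum-filter (λ x → isZero x Bool.≟ false) inH (allVecs v)) ⟩
  + sum (map (λ x → if does (isZero x Bool.≟ false) then inH x else 0) (allVecs v))
    ≡⟨ cong (+_ ∘ sum) (map-cong pointwise (allVecs v)) ⟩
  + sum (map (λ x → if dot a x then 0 else mult M x) (allVecs v))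
    ≡⟨ sum-allVecs v (λ x → if dot a x then 0 else mult M x) ⟩
  ∑[ x ∈𝔽₂^ v ] (+ (if dot a x then 0 else mult M x))
    ≡⟨ ∑-cong (λ x → if-float +_ (dot a x)) ⟩
  ∑[ x ∈𝔽₂^ v ] (if dot a x then 0ℤ else + mult M x) ∎
  where
  open ≡-Reasoning
  inH : Vec Bool v → ℕ
  inH x = if does (dot a x Bool.≟ false) then M x else 0
  pointwise : ∀ x → (if does (isZero x Bool.≟ false) then inH x else 0)
                  ≡ (if dot a x then 0 else mult M x)
  pointwise x with isZero x | dot a x
  ... | true  | true  = refl
  ... | true  | false = refl
  ... | false | true  = refl
  ... | false | false = refl

hypMass≤card : ∀ {v} (M : Multiset v) a → hypMass M a ≤ card M
hypMass≤card {v} M a =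
  ℤ.drop‿+≤+ (subst₂ ℤ._≤_ (sym (hypMass-∑ M a)) (sym (card-∑ M)) (∑-mono-≤ pointwise))
  where
  pointwise : ∀ x → (if dot a x then 0ℤ else + mult M x) ℤ.≤ + mult M x
  pointwise x with dot a x
  ... | true  = +≤+ z≤n
  ... | false = ℤ.≤-refl

hypMass-𝟎 : ∀ {v} (M : Multiset v) → hypMass M 𝟎 ≡ card M
hypMass-𝟎 M = ℤ.+-injective (trans (hypMass-∑ M 𝟎)
  (trans (∑-cong (λ x → cong (λ b → if b then 0ℤ else + mult M x) (dotˡ-𝟎 x))) (sym (card-∑ M))))

𝓕-mult : ∀ {v} (M : Multiset v) a → 𝓕 (+_ ∘ mult M) a + + card M ≡ + 2 * + hypMass M a
𝓕-mult {v} M a = begin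
  𝓕 m a + + card M                                       ≡⟨ cong (_+_ (𝓕 m a)) (card-∑ M) ⟩
  𝓕 m a + ∑ v m                                          ≡⟨ 𝓕-+-∑ m a ⟩
  + 2 * ∑[ x ∈𝔽₂^ v ] (if dot a x then 0ℤ else m x)      ≡⟨ cong (+ 2 *_) (hypMass-∑ M a) ⟨
  + 2 * + hypMass M a                                    ∎
  where
  open ≡-Reasoning
  m = +_ ∘ mult M

hypMass-divisible : ∀ {v} Δ .{{_ : ℕ.NonZero Δ}} (M : Multiset v) →
                    Divisible Δ M → Δ ∣ card M → ∀ a → Δ ∣ hypMass M a
hypMass-divisible Δ M div Δ∣#M a with isZero a in a≟𝟎
... | false = m%n≡0⇒n∣m _ Δ (trans (div a a≟𝟎) (n∣m⇒m%n≡0 _ Δ Δ∣#M))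
... | true rewrite isZero⇒≡𝟎 a a≟𝟎 | hypMass-𝟎 M = Δ∣#M

light-multiset-not-8-divisible : ∀ {v} (M : Multiset v) → (∀ x → mult M x ≤ 3) →
                                 Divisible 8 M → card M ≡ 24 → ⊥
light-multiset-not-8-divisible {v} M light div #M≡24 =
  quadratic-gap (∑² m) (∑⁴ m) ∑²≤72 ∑⁴≤9∑²
    (subst (+ 2 * (∑² m * ∑² m) - ∑⁴ m ℤ.≤_) ∑²-autocorrelation (∑²-autocorrelation-lower-bound m 0≤m))
  where
  m : Vec Bool v → ℤ
  m = +_ ∘ mult M
  0≤m : ∀ x → 0ℤ ℤ.≤ m x
  0≤m x = +≤+ z≤n
  m≤3 : ∀ x → m x ℤ.≤ + 3
  m≤3 x = +≤+ (light x)
  ∑m≡24 : ∑ v m ≡ + 24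
  ∑m≡24 = trans (sym (card-∑ M)) (cong +_ #M≡24)
  quartic : ∀ a → (𝓕 m a * 𝓕 m a) * (𝓕 m a * 𝓕 m a) ≡ + 640 * (𝓕 m a * 𝓕 m a) - + 36864
  quartic a = hyperplane-quartic (hypMass M a) (𝓕 m a)
    (hypMass-divisible 8 M div (subst (8 ∣_) (sym #M≡24) (divides 3 refl)) a)
    (subst (hypMass M a ≤_) #M≡24 (hypMass≤card M a))
    (subst (λ n → 𝓕 m a + + n ≡ + 2 * + hypMass M a) #M≡24 (𝓕-mult M a))
  ∑²-autocorrelation : ∑² (autocorrelation m) ≡ + 640 * ∑² m - + 36864
  ∑²-autocorrelation = ∑²-autocorrelation-of-quartic m (+ 640) (+ 36864) quartic
  ∑²≤72 : ∑² m ℤ.≤ + 72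
  ∑²≤72 = ℤ.≤-trans (∑-mono-≤ (λ x → square-≤ (+ 3) (0≤m x) (m≤3 x)))
            (ℤ.≤-reflexive (trans (∑-distribˡ-* (+ 3) m) (cong (+ 3 *_) ∑m≡24)))
  m²≤9 : ∀ x → m x * m x ℤ.≤ + 9
  m²≤9 x = ℤ.≤-trans (square-≤ (+ 3) (0≤m x) (m≤3 x)) (ℤ.*-monoˡ-≤-nonNeg (+ 3) (m≤3 x))
  ∑⁴≤9∑² : ∑⁴ m ℤ.≤ + 9 * ∑² m
  ∑⁴≤9∑² = ℤ.≤-trans (∑-mono-≤ (λ x → square-≤ (+ 9) (*-nonNeg (0≤m x) (0≤m x)) (m²≤9 x)))
             (ℤ.≤-reflexive (∑-distribˡ-* (+ 9) (λ x → m x * m x)))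

lemma40 : (v : ℕ) (M : Multiset v) → Divisible 8 M → card M ≡ 24 →
    Σ (Vec Bool v) (λ P → IsPoint P × 4 ≤ M P)
lemma40 v M div #M≡24 = decidable-stable (∃? v heavy?) λ no-heavy →
  light-multiset-not-8-divisible M (mult≤3 no-heavy) div #M≡24
  where
  heavy? : ∀ x → Dec (IsPoint x × 4 ≤ M x)
  heavy? x = (isZero x Bool.≟ false) ×-dec (4 ℕ.≤? M x)
  mult≤3 : ¬ ∃ (λ x → IsPoint x × 4 ≤ M x) → ∀ x → mult M x ≤ 3
  mult≤3 no-heavy x with isZero x in x≟𝟎
  ... | true  = z≤n
  ... | false = ℕ.≤-pred (ℕ.≰⇒> (λ 4≤Mx → no-heavy (x , x≟𝟎 , 4≤Mx)))
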